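{- For $m,n\in\mathbb{Z}_{\geq 0}$ and $k\in\mathbb{Z}$, \[ B_{m}^{(k)}(n) = \sum_{q=1}^{m+1}\sum_{i=0}^{n}(-1)^{m+n+q-i-1}\frac{(q-1)!}{q^{k}}{n \brack i}{m+i \brace n+q-1}. \]
   Context: For $k\in\mathbb{Z}$ let $\mathrm{Li}_k(z)=\sum_{m\ge1} z^m/m^k$. The poly-Bernoulli polynomials $B_n^{(k)}(x)$ are defined by $e^{ -xt}\frac{\mathrm{Li}_k(1-e^{ -t})}{1-e^{ -t}}=\sum_{n\ge0}B_n^{(k)}(x)\frac{t^n}{n!}$. Stirling numbers of the first kind: ${0\brack 0}=1$, ${n\brack 0}={0\brack m}=0$ for $m,n\neq0$, ${n+1\brack m}={n\brack m-1}+n{n\brack m}$ ($n\ge0,m\ge1$). Stirling numbers of the second kind: ${0\brace 0}=1$, ${n\brace 0}={0\brace m}=0$ for $m,n\neq0$, ${n+1\brace m}={n\brace m-1}+m{n\brace m}$ ($n\ge0,m\ge1$). -}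

module Defs where

open import Data.Nat as ℕ using (ℕ; zero; suc; _∸_; NonZero)
open import Data.Nat.Properties using (m^n≢0; _!≢0)
open import Data.Nat.Base using (_!)
open import Data.Integer as ℤ using (ℤ; +_; -[1+_])
open import Data.Rational using (ℚ; _/_; _+_; _*_; -_; 0ℚ; 1ℚ)

ℕ→ℚ : ℕ → ℚ
ℕ→ℚ n = + n / 1

_^ℚ_ : ℚ → ℕ → ℚ
a ^ℚ zero = 1ℚ
a ^ℚ suc n = a * (a ^ℚ n)

invPow : (q : ℕ) → .{{NonZero q}} → ℤ → ℚ
invPow q (+ n) = (+ 1 / (q ℕ.^ n)) {{m^n≢0 q n}}
invPow q -[1+ n ] = ℕ→ℚ (q ℕ.^ suc n)

sumTo : ℕ → (ℕ → ℚ) → ℚ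
sumTo zero f = f 0
sumTo (suc n) f = sumTo n f + f (suc n)

-- formal power series over ℚ, as coefficient sequences (coefficient of t^n)
Series : Set
Series = ℕ → ℚ

_⊛_ : Series → Series → Series
(f ⊛ g) n = sumTo n (λ i → f i * g (n ∸ i))

oneS : Series
oneS zero = 1ℚ
oneS (suc n) = 0ℚ

powS : Series → ℕ → Series
powS f zero = oneS
powS f (suc j) = f ⊛ powS f j

expS : ℚ → Series
expS a n = (a ^ℚ n) * (+ 1 / (n !)) {{n !≢0}}

oneMinusExpNeg : Series
oneMinusExpNeg zero = 0ℚ
oneMinusExpNeg (suc n) = ((- 1ℚ) ^ℚ n) * (+ 1 / (suc n !)) {{suc n !≢0}}

-- Li_k(1 - e^{-t}) / (1 - e^{-t}) = Σ_{m ≥ 1} (1 - e^{-t})^{m-1} / m^k.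
-- Since (1 - e^{-t})^{m-1} has order m-1, only m ≤ n+1 contribute to t^n.
liQuot : ℤ → Series
liQuot k n = sumTo n (λ j → invPow (suc j) k * powS oneMinusExpNeg j n)

-- poly-Bernoulli polynomial B_n^{(k)}(x) = n! [t^n] e^{-xt} Li_k(1-e^{-t})/(1-e^{-t})
polyBernoulli : ℕ → ℤ → ℚ → ℚ
polyBernoulli n k x = ℕ→ℚ (n !) * (expS (- x) ⊛ liQuot k) n

-- Stirling numbers of the first kind (unsigned)
stirling1 : ℕ → ℕ → ℕ
stirling1 zero zero = 1
stirling1 zero (suc m) = 0
stirling1 (suc n) zero = 0
stirling1 (suc n) (suc m) = stirling1 n m ℕ.+ n ℕ.* stirling1 n (suc m)

stirling2 : ℕ → ℕ → ℕ
stirling2 zero zero = 1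
stirling2 zero (suc m) = 0
stirling2 (suc n) zero = 0
stirling2 (suc n) (suc m) = stirling2 n m ℕ.+ suc m ℕ.* stirling2 n (suc m)

-- Put E = e^{-nt} and g = 1 - e^{-t}.  As g^p has order p, the coefficient of t^m in
-- E Li_k(g)/g = Σ_p (p+1)^{-k} E g^p only involves p ≤ m, so it suffices to know G(m, p) = m! [t^m] E g^p.
-- From E' = -n E and g' = 1 - g the Leibniz rule gives
--   G(0, p) = δ_{0p},   G(m+1, p) = -(n+p) G(m, p) + p G(m, p-1),
-- and the recurrence S(N+1, j+1) = S(N, j) + (j+1) S(N, j+1), together with the orthogonality
-- Σ_i (-1)^{n+i} s(n, i) S(i, j) = δ_{nj}, shows that (-1)^{m+p} p! Σ_i (-1)^{n+i} s(n, i) S(m+i, n+p)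
-- satisfies the same recurrence.
module Submission where

open import Data.Nat.Base as ℕ using (ℕ; zero; suc; _∸_; _!; _≤_; _<_; z≤n; s≤s; NonZero)
import Data.Nat.Properties as ℕ
open import Data.Nat.Properties using (_!≢0)
open import Data.Integer.Base as ℤ using (ℤ)
import Data.Integer.Properties as ℤ
open import Data.Rational.Base using (ℚ; _+_; _*_; -_; _-_; 0ℚ; 1ℚ; _/_; toℚᵘ; fromℚᵘ)
open import Data.Rational.Properties
import Data.Rational.Unnormalised.Base as ℚᵘ
import Data.Rational.Unnormalised.Properties as ℚᵘ
open import Data.Rational.Solver using (module +-*-Solver)
open import Data.Product.Base using (_,_)
open import Data.List.Base using (_∷_; [])
import Data.Nat.Tactic.RingSolver as ℕ-Solver
open import Relation.Nullary.Decidable.Core using (yes; no)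
open import Relation.Binary.PropositionalEquality
open import Defs

open +-*-Solver

fromℚᵘ-+ : ∀ p q → fromℚᵘ (p ℚᵘ.+ q) ≡ fromℚᵘ p + fromℚᵘ q
fromℚᵘ-+ p q = toℚᵘ-injective (begin
  toℚᵘ (fromℚᵘ (p ℚᵘ.+ q))             ≈⟨ toℚᵘ-fromℚᵘ (p ℚᵘ.+ q) ⟩
  p ℚᵘ.+ q                              ≈⟨ ℚᵘ.+-cong (ℚᵘ.≃-sym (toℚᵘ-fromℚᵘ p)) (ℚᵘ.≃-sym (toℚᵘ-fromℚᵘ q)) ⟩
  toℚᵘ (fromℚᵘ p) ℚᵘ.+ toℚᵘ (fromℚᵘ q) ≈⟨ ℚᵘ.≃-sym (toℚᵘ-homo-+ (fromℚᵘ p) (fromℚᵘ q)) ⟩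
  toℚᵘ (fromℚᵘ p + fromℚᵘ q)           ∎)
  where open ℚᵘ.≃-Reasoning

fromℚᵘ-* : ∀ p q → fromℚᵘ (p ℚᵘ.* q) ≡ fromℚᵘ p * fromℚᵘ q
fromℚᵘ-* p q = toℚᵘ-injective (begin
  toℚᵘ (fromℚᵘ (p ℚᵘ.* q))             ≈⟨ toℚᵘ-fromℚᵘ (p ℚᵘ.* q) ⟩
  p ℚᵘ.* q                              ≈⟨ ℚᵘ.*-cong (ℚᵘ.≃-sym (toℚᵘ-fromℚᵘ p)) (ℚᵘ.≃-sym (toℚᵘ-fromℚᵘ q)) ⟩
  toℚᵘ (fromℚᵘ p) ℚᵘ.* toℚᵘ (fromℚᵘ q) ≈⟨ ℚᵘ.≃-sym (toℚᵘ-homo-* (fromℚᵘ p) (fromℚᵘ q)) ⟩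
  toℚᵘ (fromℚᵘ p * fromℚᵘ q)           ∎)
  where open ℚᵘ.≃-Reasoning

-- ℕ→ℚ a is, definitionally, fromℚᵘ of the unnormalised fraction a / 1.
ℕ→ℚ-+ : ∀ a b → ℕ→ℚ (a ℕ.+ b) ≡ ℕ→ℚ a + ℕ→ℚ b
ℕ→ℚ-+ a b = trans (fromℚᵘ-cong ≃) (fromℚᵘ-+ (ℚᵘ.mkℚᵘ (ℤ.+ a) 0) (ℚᵘ.mkℚᵘ (ℤ.+ b) 0))
  where
  ≃ : ℚᵘ.mkℚᵘ (ℤ.+ (a ℕ.+ b)) 0 ℚᵘ.≃ ℚᵘ.mkℚᵘ (ℤ.+ a) 0 ℚᵘ.+ ℚᵘ.mkℚᵘ (ℤ.+ b) 0
  ≃ = ℚᵘ.*≡* (cong (ℤ._* ℤ.+ 1) (trans (ℤ.pos-+ a b)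
        (sym (cong₂ ℤ._+_ (ℤ.*-identityʳ (ℤ.+ a)) (ℤ.*-identityʳ (ℤ.+ b))))))

ℕ→ℚ-* : ∀ a b → ℕ→ℚ (a ℕ.* b) ≡ ℕ→ℚ a * ℕ→ℚ b
ℕ→ℚ-* a b = trans (fromℚᵘ-cong ≃) (fromℚᵘ-* (ℚᵘ.mkℚᵘ (ℤ.+ a) 0) (ℚᵘ.mkℚᵘ (ℤ.+ b) 0))
  where
  ≃ : ℚᵘ.mkℚᵘ (ℤ.+ (a ℕ.* b)) 0 ℚᵘ.≃ ℚᵘ.mkℚᵘ (ℤ.+ a) 0 ℚᵘ.* ℚᵘ.mkℚᵘ (ℤ.+ b) 0
  ≃ = ℚᵘ.*≡* (cong (ℤ._* ℤ.+ 1) (ℤ.pos-* a b))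

ℕ→ℚ-*-1/ : ∀ q d .{{_ : NonZero d}} →
           ℕ→ℚ (suc q) * (ℤ.+ 1 / (suc q ℕ.* d)) {{ℕ.m*n≢0 (suc q) d}} ≡ ℤ.+ 1 / d
ℕ→ℚ-*-1/ q (suc d) =
  trans (sym (fromℚᵘ-* (ℚᵘ.mkℚᵘ (ℤ.+ suc q) 0) (ℚᵘ.mkℚᵘ (ℤ.+ 1) (d ℕ.+ q ℕ.* suc d)))) (fromℚᵘ-cong ≃)
  where
  ≃ : ℚᵘ.mkℚᵘ (ℤ.+ suc q) 0 ℚᵘ.* ℚᵘ.mkℚᵘ (ℤ.+ 1) (d ℕ.+ q ℕ.* suc d) ℚᵘ.≃ ℚᵘ.mkℚᵘ (ℤ.+ 1) d
  ≃ = ℚᵘ.*≡* (trans (cong (ℤ._* ℤ.+ suc d) (ℤ.*-identityʳ (ℤ.+ suc q)))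
        (sym (trans (ℤ.*-identityˡ _) (cong ℤ.+_ (ℕ.*-identityˡ (suc q ℕ.* suc d))))))

^ℚ-+ : ∀ x a b → x ^ℚ (a ℕ.+ b) ≡ x ^ℚ a * x ^ℚ b
^ℚ-+ x zero    b = sym (*-identityˡ (x ^ℚ b))
^ℚ-+ x (suc a) b = trans (cong (x *_) (^ℚ-+ x a b)) (sym (*-assoc x (x ^ℚ a) (x ^ℚ b)))

sgn : ℕ → ℚ
sgn a = (- 1ℚ) ^ℚ a

sgn-+-self : ∀ a → sgn (a ℕ.+ a) ≡ 1ℚ
sgn-+-self a = trans (^ℚ-+ (- 1ℚ) a a) (square a)
  where
  square : ∀ a → sgn a * sgn a ≡ 1ℚ
  square zero    = refl
  square (suc a) = trans (solve 1 (λ s → (:- con 1ℚ :* s) :* (:- con 1ℚ :* s) := s :* s) refl (sgn a))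
                         (square a)

sumTo-cong≤ : ∀ n {f g : ℕ → ℚ} → (∀ i → i ≤ n → f i ≡ g i) → sumTo n f ≡ sumTo n g
sumTo-cong≤ zero    f≡g = f≡g 0 z≤n
sumTo-cong≤ (suc n) f≡g =
  cong₂ _+_ (sumTo-cong≤ n (λ i i≤n → f≡g i (ℕ.m≤n⇒m≤1+n i≤n))) (f≡g (suc n) ℕ.≤-refl)

sumTo-cong : ∀ n {f g : ℕ → ℚ} → f ≗ g → sumTo n f ≡ sumTo n g
sumTo-cong n f≗g = sumTo-cong≤ n (λ i _ → f≗g i)

sumTo-zero : ∀ n {f : ℕ → ℚ} → (∀ i → i ≤ n → f i ≡ 0ℚ) → sumTo n f ≡ 0ℚ
sumTo-zero zero    f≡0 = f≡0 0 z≤n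
sumTo-zero (suc n) f≡0 =
  cong₂ _+_ (sumTo-zero n (λ i i≤n → f≡0 i (ℕ.m≤n⇒m≤1+n i≤n))) (f≡0 (suc n) ℕ.≤-refl)

sumTo-distrib-+ : ∀ n (f g : ℕ → ℚ) → sumTo n (λ i → f i + g i) ≡ sumTo n f + sumTo n g
sumTo-distrib-+ zero    f g = refl
sumTo-distrib-+ (suc n) f g = trans (cong (_+ (f (suc n) + g (suc n))) (sumTo-distrib-+ n f g))
  (solve 4 (λ a b c d → (a :+ b) :+ (c :+ d) := (a :+ c) :+ (b :+ d)) refl
     (sumTo n f) (sumTo n g) (f (suc n)) (g (suc n)))

*-distribˡ-sumTo : ∀ n c (f : ℕ → ℚ) → c * sumTo n f ≡ sumTo n (λ i → c * f i)
*-distribˡ-sumTo zero    c f = refl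
*-distribˡ-sumTo (suc n) c f =
  trans (*-distribˡ-+ c (sumTo n f) (f (suc n))) (cong (_+ c * f (suc n)) (*-distribˡ-sumTo n c f))

sumTo-distrib-sub : ∀ n (f g : ℕ → ℚ) → sumTo n (λ i → f i - g i) ≡ sumTo n f - sumTo n g
sumTo-distrib-sub n f g = begin
  sumTo n (λ i → f i - g i)
    ≡⟨ sumTo-cong n (λ i → solve 2 (λ x y → x :- y := x :+ (:- con 1ℚ) :* y) refl (f i) (g i)) ⟩
  sumTo n (λ i → f i + (- 1ℚ) * g i)
    ≡⟨ sumTo-distrib-+ n f _ ⟩
  sumTo n f + sumTo n (λ i → (- 1ℚ) * g i)
    ≡⟨ cong (sumTo n f +_) (sym (*-distribˡ-sumTo n (- 1ℚ) g)) ⟩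
  sumTo n f + (- 1ℚ) * sumTo n g
    ≡⟨ solve 2 (λ x y → x :+ (:- con 1ℚ) :* y := x :- y) refl (sumTo n f) (sumTo n g) ⟩
  sumTo n f - sumTo n g ∎
  where open ≡-Reasoning

sumTo-head : ∀ n (f : ℕ → ℚ) → sumTo (suc n) f ≡ f 0 + sumTo n (λ i → f (suc i))
sumTo-head zero    f = refl
sumTo-head (suc n) f = trans (cong (_+ f (suc (suc n))) (sumTo-head n f))
                             (+-assoc (f 0) (sumTo n (λ i → f (suc i))) (f (suc (suc n))))

sumTo-comm : ∀ a b (f : ℕ → ℕ → ℚ) →
             sumTo a (λ i → sumTo b (λ j → f i j)) ≡ sumTo b (λ j → sumTo a (λ i → f i j))
sumTo-comm zero    b f = refl
sumTo-comm (suc a) b f = trans (cong (_+ sumTo b (f (suc a))) (sumTo-comm a b f))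
                               (sym (sumTo-distrib-+ b (λ j → sumTo a (λ i → f i j)) (f (suc a))))

sumTo-vanishing-tail : ∀ {a m} (f : ℕ → ℚ) → a ≤ m → (∀ j → a < j → f j ≡ 0ℚ) → sumTo m f ≡ sumTo a f
sumTo-vanishing-tail {a} {m} f a≤m f≡0 = begin
  sumTo m f                ≡⟨ cong (λ l → sumTo l f) (sym (ℕ.m+[n∸m]≡n a≤m)) ⟩
  sumTo (a ℕ.+ (m ∸ a)) f ≡⟨ extend (m ∸ a) ⟩
  sumTo a f                ∎
  where
  open ≡-Reasoning
  extend : ∀ b → sumTo (a ℕ.+ b) f ≡ sumTo a f
  extend zero    = cong (λ l → sumTo l f) (ℕ.+-identityʳ a)
  extend (suc b) = begin
    sumTo (a ℕ.+ suc b) f                 ≡⟨ cong (λ l → sumTo l f) (ℕ.+-suc a b) ⟩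
    sumTo (a ℕ.+ b) f + f (suc (a ℕ.+ b)) ≡⟨ cong₂ _+_ (extend b) (f≡0 _ (s≤s (ℕ.m≤m+n a b))) ⟩
    sumTo a f + 0ℚ                        ≡⟨ +-identityʳ _ ⟩
    sumTo a f                             ∎

_VanishesBelow_ : Series → ℕ → Set
f VanishesBelow j = ∀ N → N < j → f N ≡ 0ℚ

∂ : Series → Series
∂ f n = ℕ→ℚ (suc n) * f (suc n)

⊛-congˡ : ∀ {f f′} g → f ≗ f′ → (f ⊛ g) ≗ (f′ ⊛ g)
⊛-congˡ g f≗f′ n = sumTo-cong n (λ i → cong (_* g (n ∸ i)) (f≗f′ i))

⊛-congʳ : ∀ f {g g′} → g ≗ g′ → (f ⊛ g) ≗ (f ⊛ g′)
⊛-congʳ f g≗g′ n = sumTo-cong n (λ i → cong (f i *_) (g≗g′ (n ∸ i)))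

⊛-identityˡ : ∀ f → (oneS ⊛ f) ≗ f
⊛-identityˡ f zero    = *-identityˡ (f 0)
⊛-identityˡ f (suc n) = begin
  sumTo (suc n) (λ i → oneS i * f (suc n ∸ i))       ≡⟨ sumTo-head n (λ i → oneS i * f (suc n ∸ i)) ⟩
  1ℚ * f (suc n) + sumTo n (λ i → 0ℚ * f (n ∸ i))
    ≡⟨ cong₂ _+_ (*-identityˡ (f (suc n))) (sumTo-zero n (λ i _ → *-zeroˡ (f (n ∸ i)))) ⟩
  f (suc n) + 0ℚ                                    ≡⟨ +-identityʳ _ ⟩
  f (suc n)                                         ∎
  where open ≡-Reasoning

⊛-*ˡ : ∀ c f g → ((λ N → c * f N) ⊛ g) ≗ (λ n → c * (f ⊛ g) n)
⊛-*ˡ c f g n = trans (sumTo-cong n (λ i → *-assoc c (f i) (g (n ∸ i)))) (sym (*-distribˡ-sumTo n c _))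

⊛-subˡ : ∀ f f′ g → ((λ N → f N - f′ N) ⊛ g) ≗ (λ n → (f ⊛ g) n - (f′ ⊛ g) n)
⊛-subˡ f f′ g n = trans
  (sumTo-cong n (λ i → solve 3 (λ x x′ y → (x :- x′) :* y := x :* y :- x′ :* y) refl (f i) (f′ i) (g (n ∸ i))))
  (sumTo-distrib-sub n (λ i → f i * g (n ∸ i)) (λ i → f′ i * g (n ∸ i)))

⊛-*ʳ : ∀ f c g → (f ⊛ (λ N → c * g N)) ≗ (λ n → c * (f ⊛ g) n)
⊛-*ʳ f c g n = trans (sumTo-cong n (λ i → solve 3 (λ x c y → x :* (c :* y) := c :* (x :* y)) refl (f i) c (g (n ∸ i))))
                     (sym (*-distribˡ-sumTo n c (λ i → f i * g (n ∸ i))))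

⊛-subʳ : ∀ f g g′ → (f ⊛ (λ N → g N - g′ N)) ≗ (λ n → (f ⊛ g) n - (f ⊛ g′) n)
⊛-subʳ f g g′ n = trans
  (sumTo-cong n (λ i → solve 3 (λ x y y′ → x :* (y :- y′) := x :* y :- x :* y′) refl (f i) (g (n ∸ i)) (g′ (n ∸ i))))
  (sumTo-distrib-sub n (λ i → f i * g (n ∸ i)) (λ i → f i * g′ (n ∸ i)))

⊛-*-subʳ : ∀ f c g g′ → (f ⊛ (λ N → c * (g N - g′ N))) ≗ (λ n → c * ((f ⊛ g) n - (f ⊛ g′) n))
⊛-*-subʳ f c g g′ n = trans (⊛-*ʳ f c (λ N → g N - g′ N) n) (cong (c *_) (⊛-subʳ f g g′ n))

⊛-zeroʳ : ∀ f {g} → g ≗ (λ _ → 0ℚ) → (f ⊛ g) ≗ (λ _ → 0ℚ)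
⊛-zeroʳ f g≗0 n = sumTo-zero n (λ i _ → trans (cong (f i *_) (g≗0 (n ∸ i))) (*-zeroʳ (f i)))

∂-oneS : ∂ oneS ≗ (λ _ → 0ℚ)
∂-oneS n = *-zeroʳ (ℕ→ℚ (suc n))

-- Split the factor n+1 as i + (n+1-i): the i = 0 term of the first part and the i = n+1 term of the
-- second part vanish.
∂-⊛ : ∀ f g n → ∂ (f ⊛ g) n ≡ (∂ f ⊛ g) n + (f ⊛ ∂ g) n
∂-⊛ f g n = begin
  ℕ→ℚ (suc n) * sumTo (suc n) (λ i → f i * g (suc n ∸ i))
    ≡⟨ *-distribˡ-sumTo (suc n) (ℕ→ℚ (suc n)) (λ i → f i * g (suc n ∸ i)) ⟩
  sumTo (suc n) (λ i → ℕ→ℚ (suc n) * (f i * g (suc n ∸ i)))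
    ≡⟨ sumTo-cong≤ (suc n) split ⟩
  sumTo (suc n) (λ i → left i + right i)
    ≡⟨ sumTo-distrib-+ (suc n) left right ⟩
  sumTo (suc n) left + (sumTo n right + right (suc n))
    ≡⟨ cong₂ (λ x y → x + (sumTo n right + y)) (sumTo-head n left) right-last ⟩
  (left 0 + sumTo n (λ i → left (suc i))) + (sumTo n right + 0ℚ)
    ≡⟨ cong₂ _+_ (cong (_+ sumTo n (λ i → left (suc i))) left-first) (+-identityʳ _) ⟩
  (0ℚ + (∂ f ⊛ g) n) + sumTo n right
    ≡⟨ cong₂ _+_ (+-identityˡ ((∂ f ⊛ g) n)) (sumTo-cong≤ n right≡) ⟩
  (∂ f ⊛ g) n + (f ⊛ ∂ g) n ∎
  where
  open ≡-Reasoning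
  left right : ℕ → ℚ
  left  i = ℕ→ℚ i * f i * g (suc n ∸ i)
  right i = ℕ→ℚ (suc n ∸ i) * f i * g (suc n ∸ i)
  split : ∀ i → i ≤ suc n → ℕ→ℚ (suc n) * (f i * g (suc n ∸ i)) ≡ left i + right i
  split i i≤1+n = begin
    ℕ→ℚ (suc n) * (f i * g (suc n ∸ i))
      ≡⟨ cong (λ l → ℕ→ℚ l * (f i * g (suc n ∸ i))) (sym (ℕ.m+[n∸m]≡n i≤1+n)) ⟩
    ℕ→ℚ (i ℕ.+ (suc n ∸ i)) * (f i * g (suc n ∸ i))
      ≡⟨ cong (_* (f i * g (suc n ∸ i))) (ℕ→ℚ-+ i (suc n ∸ i)) ⟩
    (ℕ→ℚ i + ℕ→ℚ (suc n ∸ i)) * (f i * g (suc n ∸ i))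
      ≡⟨ solve 4 (λ a b x y → (a :+ b) :* (x :* y) := a :* x :* y :+ b :* x :* y) refl
           (ℕ→ℚ i) (ℕ→ℚ (suc n ∸ i)) (f i) (g (suc n ∸ i)) ⟩
    left i + right i ∎
  left-first : left 0 ≡ 0ℚ
  left-first = trans (cong (_* g (suc n)) (*-zeroˡ (f 0))) (*-zeroˡ (g (suc n)))
  right-last : right (suc n) ≡ 0ℚ
  right-last = begin
    ℕ→ℚ (n ∸ n) * f (suc n) * g (n ∸ n) ≡⟨ cong (λ l → ℕ→ℚ l * f (suc n) * g (n ∸ n)) (ℕ.n∸n≡0 n) ⟩
    0ℚ * f (suc n) * g (n ∸ n)          ≡⟨ cong (_* g (n ∸ n)) (*-zeroˡ (f (suc n))) ⟩
    0ℚ * g (n ∸ n)                      ≡⟨ *-zeroˡ (g (n ∸ n)) ⟩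
    0ℚ                                  ∎
  right≡ : ∀ i → i ≤ n → right i ≡ f i * ∂ g (n ∸ i)
  right≡ i i≤n = begin
    ℕ→ℚ (suc n ∸ i) * f i * g (suc n ∸ i)       ≡⟨ cong (λ l → ℕ→ℚ l * f i * g l) (ℕ.+-∸-assoc 1 i≤n) ⟩
    ℕ→ℚ (suc (n ∸ i)) * f i * g (suc (n ∸ i))   ≡⟨ solve 3 (λ a x y → a :* x :* y := x :* (a :* y)) refl
                                                     (ℕ→ℚ (suc (n ∸ i))) (f i) (g (suc (n ∸ i))) ⟩
    f i * ∂ g (n ∸ i)                           ∎

⊛-vanishesBelow : ∀ {f g a b} → f VanishesBelow a → g VanishesBelow b → (f ⊛ g) VanishesBelow (a ℕ.+ b)
⊛-vanishesBelow {f} {g} {a} {b} f≡0 g≡0 N N<a+b = sumTo-zero N term≡0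
  where
  term≡0 : ∀ i → i ≤ N → f i * g (N ∸ i) ≡ 0ℚ
  term≡0 i i≤N with i ℕ.<? a
  ... | yes i<a = trans (cong (_* g (N ∸ i)) (f≡0 i i<a)) (*-zeroˡ (g (N ∸ i)))
  ... | no  i≮a = trans (cong (f i *_) (g≡0 (N ∸ i) N∸i<b)) (*-zeroʳ (f i))
    where
    N∸i<b : N ∸ i < b
    N∸i<b = subst (N ∸ i <_) (ℕ.m+n∸m≡n i b)
      (ℕ.∸-monoˡ-< (ℕ.<-≤-trans N<a+b (ℕ.+-monoˡ-≤ b (ℕ.≮⇒≥ i≮a))) i≤N)

powS-vanishesBelow : ∀ {f} → f VanishesBelow 1 → ∀ j → powS f j VanishesBelow j
powS-vanishesBelow f≡0 zero    N ()
powS-vanishesBelow f≡0 (suc j) = ⊛-vanishesBelow f≡0 (powS-vanishesBelow f≡0 j)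

⊛-sumTo-triangular : ∀ f (c : ℕ → Series) → (∀ j → c j VanishesBelow j) → ∀ m →
                     (f ⊛ (λ N → sumTo N (λ j → c j N))) m ≡ sumTo m (λ j → (f ⊛ c j) m)
⊛-sumTo-triangular f c c≡0 m = begin
  sumTo m (λ i → f i * sumTo (m ∸ i) (λ j → c j (m ∸ i)))
    ≡⟨ sumTo-cong m (λ i → cong (f i *_) (sym (sumTo-vanishing-tail _ (ℕ.m∸n≤m m i) (λ j → c≡0 j (m ∸ i))))) ⟩
  sumTo m (λ i → f i * sumTo m (λ j → c j (m ∸ i)))
    ≡⟨ sumTo-cong m (λ i → *-distribˡ-sumTo m (f i) _) ⟩
  sumTo m (λ i → sumTo m (λ j → f i * c j (m ∸ i)))
    ≡⟨ sumTo-comm m m _ ⟩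
  sumTo m (λ j → (f ⊛ c j) m) ∎
  where open ≡-Reasoning

coeff! : Series → ℕ → ℚ
coeff! f m = ℕ→ℚ (m !) * f m

coeff!-suc : ∀ f m → coeff! f (suc m) ≡ coeff! (∂ f) m
coeff!-suc f m = trans (cong (_* f (suc m)) (ℕ→ℚ-* (suc m) (m !)))
  (solve 3 (λ q c x → q :* c :* x := c :* (q :* x)) refl (ℕ→ℚ (suc m)) (ℕ→ℚ (m !)) (f (suc m)))

∂-expS : ∀ a → ∂ (expS a) ≗ (λ n → a * expS a n)
∂-expS a n = begin
  ℕ→ℚ (suc n) * (a * a ^ℚ n * 1/[1+n]!)
    ≡⟨ solve 4 (λ q x y z → q :* (x :* y :* z) := x :* (y :* (q :* z))) refl (ℕ→ℚ (suc n)) a (a ^ℚ n) 1/[1+n]! ⟩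
  a * (a ^ℚ n * (ℕ→ℚ (suc n) * 1/[1+n]!))
    ≡⟨ cong (λ x → a * (a ^ℚ n * x)) (ℕ→ℚ-*-1/ n (n !) {{n !≢0}}) ⟩
  a * expS a n ∎
  where
  open ≡-Reasoning
  1/[1+n]! = (ℤ.+ 1 / (suc n !)) {{suc n !≢0}}

∂-oneMinusExpNeg : ∂ oneMinusExpNeg ≗ (λ n → oneS n - oneMinusExpNeg n)
∂-oneMinusExpNeg zero    = refl
∂-oneMinusExpNeg (suc n) = begin
  ℕ→ℚ (suc (suc n)) * (sgn (suc n) * 1/[2+n]!)
    ≡⟨ solve 3 (λ q s z → q :* (s :* z) := s :* (q :* z)) refl (ℕ→ℚ (suc (suc n))) (sgn (suc n)) 1/[2+n]! ⟩
  sgn (suc n) * (ℕ→ℚ (suc (suc n)) * 1/[2+n]!)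
    ≡⟨ cong (sgn (suc n) *_) (ℕ→ℚ-*-1/ (suc n) (suc n !) {{suc n !≢0}}) ⟩
  (- 1ℚ) * sgn n * 1/[1+n]!
    ≡⟨ solve 2 (λ s z → (:- con 1ℚ :* s) :* z := con 0ℚ :- s :* z) refl (sgn n) 1/[1+n]! ⟩
  0ℚ - oneMinusExpNeg (suc n) ∎
  where
  open ≡-Reasoning
  1/[1+n]! = (ℤ.+ 1 / (suc n !)) {{suc n !≢0}}
  1/[2+n]! = (ℤ.+ 1 / (suc (suc n) !)) {{suc (suc n) !≢0}}

oneMinusExpNeg-vanishesBelow : oneMinusExpNeg VanishesBelow 1
oneMinusExpNeg-vanishesBelow zero    _         = refl
oneMinusExpNeg-vanishesBelow (suc N) (s≤s ())

∂-powS : ∀ {f} → ∂ f ≗ (λ n → oneS n - f n) →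
         ∀ j → ∂ (powS f (suc j)) ≗ (λ n → ℕ→ℚ (suc j) * (powS f j n - powS f (suc j) n))
∂-powS {f} ∂f≗1-f n = ∂-f[1+j] n
  where
  open ≡-Reasoning
  P : ℕ → Series
  P = powS f
  ∂f⊛P : ∀ j n → (∂ f ⊛ P j) n ≡ P j n - P (suc j) n
  ∂f⊛P j n = trans (⊛-congˡ (P j) ∂f≗1-f n)
                   (trans (⊛-subˡ oneS f (P j) n) (cong (_- P (suc j) n) (⊛-identityˡ (P j) n)))
  ∂-f[1+j] : ∀ j n → ∂ (P (suc j)) n ≡ ℕ→ℚ (suc j) * (P j n - P (suc j) n)
  ∂-f[1+j] zero n = begin
    ∂ (f ⊛ P 0) n                              ≡⟨ ∂-⊛ f (P 0) n ⟩
    (∂ f ⊛ P 0) n + (f ⊛ ∂ (P 0)) n            ≡⟨ cong₂ _+_ (∂f⊛P 0 n) (⊛-zeroʳ f ∂-oneS n) ⟩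
    (P 0 n - P 1 n) + 0ℚ                       ≡⟨ solve 1 (λ x → x :+ con 0ℚ := con 1ℚ :* x) refl (P 0 n - P 1 n) ⟩
    ℕ→ℚ 1 * (P 0 n - P 1 n)                    ∎
  ∂-f[1+j] (suc j) n = begin
    ∂ (f ⊛ P (suc j)) n                        ≡⟨ ∂-⊛ f (P (suc j)) n ⟩
    (∂ f ⊛ P (suc j)) n + (f ⊛ ∂ (P (suc j))) n
      ≡⟨ cong₂ _+_ (∂f⊛P (suc j) n)
                   (trans (⊛-congʳ f (∂-f[1+j] j) n) (⊛-*-subʳ f (ℕ→ℚ (suc j)) (P j) (P (suc j)) n)) ⟩
    Δ + ℕ→ℚ (suc j) * Δ                        ≡⟨ solve 2 (λ x q → x :+ q :* x := (con 1ℚ :+ q) :* x) refl Δ (ℕ→ℚ (suc j)) ⟩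
    (ℕ→ℚ 1 + ℕ→ℚ (suc j)) * Δ                  ≡⟨ cong (_* Δ) (sym (ℕ→ℚ-+ 1 (suc j))) ⟩
    ℕ→ℚ (suc (suc j)) * Δ                      ∎
    where Δ = P (suc j) n - P (suc (suc j)) n

expPow : ℚ → ℕ → Series
expPow a p = expS a ⊛ powS oneMinusExpNeg p

∂-expPow : ∀ a p → ∂ (expPow a (suc p)) ≗
           (λ n → a * expPow a (suc p) n + ℕ→ℚ (suc p) * (expPow a p n - expPow a (suc p) n))
∂-expPow a p n = begin
  ∂ (expS a ⊛ P (suc p)) n                         ≡⟨ ∂-⊛ (expS a) (P (suc p)) n ⟩
  (∂ (expS a) ⊛ P (suc p)) n + (expS a ⊛ ∂ (P (suc p))) n
    ≡⟨ cong₂ _+_ (trans (⊛-congˡ (P (suc p)) (∂-expS a) n) (⊛-*ˡ a (expS a) (P (suc p)) n))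
                 (trans (⊛-congʳ (expS a) (∂-powS ∂-oneMinusExpNeg p) n)
                        (⊛-*-subʳ (expS a) (ℕ→ℚ (suc p)) (P p) (P (suc p)) n)) ⟩
  a * expPow a (suc p) n + ℕ→ℚ (suc p) * (expPow a p n - expPow a (suc p) n) ∎
  where
  open ≡-Reasoning
  P = powS oneMinusExpNeg

∂-expPow-zero : ∀ a → ∂ (expPow a 0) ≗ (λ n → a * expPow a 0 n)
∂-expPow-zero a n = begin
  ∂ (expS a ⊛ oneS) n                          ≡⟨ ∂-⊛ (expS a) oneS n ⟩
  (∂ (expS a) ⊛ oneS) n + (expS a ⊛ ∂ oneS) n  ≡⟨ cong₂ _+_ (trans (⊛-congˡ oneS (∂-expS a) n) (⊛-*ˡ a (expS a) oneS n))
                                                   (⊛-zeroʳ (expS a) ∂-oneS n) ⟩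
  a * expPow a 0 n + 0ℚ                        ≡⟨ +-identityʳ _ ⟩
  a * expPow a 0 n                             ∎
  where open ≡-Reasoning

δ : ℕ → ℕ → ℚ
δ zero    zero    = 1ℚ
δ zero    (suc b) = 0ℚ
δ (suc a) zero    = 0ℚ
δ (suc a) (suc b) = δ a b

expPow-vanishesBelow : ∀ a p → expPow a p VanishesBelow p
expPow-vanishesBelow a p =
  ⊛-vanishesBelow {expS a} {a = 0} (λ _ ()) (powS-vanishesBelow oneMinusExpNeg-vanishesBelow p)

coeff!-expPow-zero : ∀ a p → coeff! (expPow a p) 0 ≡ δ 0 p
coeff!-expPow-zero a zero    = refl
coeff!-expPow-zero a (suc p) = trans (cong (ℕ→ℚ 1 *_) (expPow-vanishesBelow a (suc p) 0 (s≤s z≤n))) (*-zeroʳ (ℕ→ℚ 1))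

coeff!-expPow-suc-zero : ∀ a m → coeff! (expPow a 0) (suc m) ≡ a * coeff! (expPow a 0) m
coeff!-expPow-suc-zero a m = begin
  coeff! (expPow a 0) (suc m)      ≡⟨ coeff!-suc (expPow a 0) m ⟩
  ℕ→ℚ (m !) * ∂ (expPow a 0) m     ≡⟨ cong (ℕ→ℚ (m !) *_) (∂-expPow-zero a m) ⟩
  ℕ→ℚ (m !) * (a * expPow a 0 m)   ≡⟨ solve 3 (λ c x y → c :* (x :* y) := x :* (c :* y)) refl (ℕ→ℚ (m !)) a (expPow a 0 m) ⟩
  a * coeff! (expPow a 0) m        ∎
  where open ≡-Reasoning

coeff!-expPow-suc-suc : ∀ a m p → coeff! (expPow a (suc p)) (suc m) ≡
  a * coeff! (expPow a (suc p)) m + ℕ→ℚ (suc p) * (coeff! (expPow a p) m - coeff! (expPow a (suc p)) m)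
coeff!-expPow-suc-suc a m p = begin
  coeff! (expPow a (suc p)) (suc m)     ≡⟨ coeff!-suc (expPow a (suc p)) m ⟩
  c * ∂ (expPow a (suc p)) m            ≡⟨ cong (c *_) (∂-expPow a p m) ⟩
  c * (a * y + q * (x - y))
    ≡⟨ solve 5 (λ c a x y q → c :* (a :* y :+ q :* (x :- y)) := a :* (c :* y) :+ q :* (c :* x :- c :* y))
         refl c a x y q ⟩
  a * (c * y) + q * (c * x - c * y)     ∎
  where
  open ≡-Reasoning
  c = ℕ→ℚ (m !)
  q = ℕ→ℚ (suc p)
  x = expPow a p m
  y = expPow a (suc p) m

signedStirling1 : ℕ → ℕ → ℚ
signedStirling1 n i = sgn (n ℕ.+ i) * ℕ→ℚ (stirling1 n i)

stirling1-vanishes : ∀ n i → n < i → stirling1 n i ≡ 0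
stirling1-vanishes zero    (suc i) _         = refl
stirling1-vanishes (suc n) (suc i) (s≤s n<i) =
  cong₂ ℕ._+_ (stirling1-vanishes n i n<i)
              (trans (cong (n ℕ.*_) (stirling1-vanishes n (suc i) (ℕ.m<n⇒m<1+n n<i))) (ℕ.*-zeroʳ n))

signedStirling1-vanishes : ∀ n i → n < i → signedStirling1 n i ≡ 0ℚ
signedStirling1-vanishes n i n<i =
  trans (cong (λ c → sgn (n ℕ.+ i) * ℕ→ℚ c) (stirling1-vanishes n i n<i)) (*-zeroʳ (sgn (n ℕ.+ i)))

signedStirling1-suc-zero : ∀ n → signedStirling1 (suc n) 0 ≡ 0ℚ
signedStirling1-suc-zero n = *-zeroʳ (sgn (suc n ℕ.+ 0))

signedStirling1-suc : ∀ n i →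
  signedStirling1 (suc n) (suc i) ≡ signedStirling1 n i - ℕ→ℚ n * signedStirling1 n (suc i)
signedStirling1-suc n i = begin
  sgn (suc (n ℕ.+ suc i)) * ℕ→ℚ (stirling1 n i ℕ.+ n ℕ.* stirling1 n (suc i))
    ≡⟨ cong₂ (λ e y → (- 1ℚ) * sgn e * y) (ℕ.+-suc n i)
             (trans (ℕ→ℚ-+ (stirling1 n i) _) (cong (ℕ→ℚ (stirling1 n i) +_) (ℕ→ℚ-* n _))) ⟩
  (- 1ℚ) * ((- 1ℚ) * s) * (x + ℕ→ℚ n * y)
    ≡⟨ solve 4 (λ s x a y → (:- con 1ℚ) :* ((:- con 1ℚ) :* s) :* (x :+ a :* y) := s :* x :- a :* ((:- con 1ℚ :* s) :* y))
         refl s x (ℕ→ℚ n) y ⟩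
  s * x - ℕ→ℚ n * ((- 1ℚ) * s * y)
    ≡⟨ cong (λ e → s * x - ℕ→ℚ n * (sgn e * y)) (sym (ℕ.+-suc n i)) ⟩
  signedStirling1 n i - ℕ→ℚ n * signedStirling1 n (suc i) ∎
  where
  open ≡-Reasoning
  s = sgn (n ℕ.+ i)
  x = ℕ→ℚ (stirling1 n i)
  y = ℕ→ℚ (stirling1 n (suc i))

stirlingProduct : ℕ → ℕ → ℕ → ℚ
stirlingProduct n m j = sumTo n (λ i → signedStirling1 n i * ℕ→ℚ (stirling2 (m ℕ.+ i) j))

stirlingProduct-suc : ∀ n m j →
  stirlingProduct n (suc m) (suc j) ≡ stirlingProduct n m j + ℕ→ℚ (suc j) * stirlingProduct n m (suc j)
stirlingProduct-suc n m j = begin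
  sumTo n (λ i → s i * ℕ→ℚ (S i j ℕ.+ suc j ℕ.* S i (suc j)))
    ≡⟨ sumTo-cong n split ⟩
  sumTo n (λ i → s i * ℕ→ℚ (S i j) + ℕ→ℚ (suc j) * (s i * ℕ→ℚ (S i (suc j))))
    ≡⟨ sumTo-distrib-+ n _ _ ⟩
  stirlingProduct n m j + sumTo n (λ i → ℕ→ℚ (suc j) * (s i * ℕ→ℚ (S i (suc j))))
    ≡⟨ cong (stirlingProduct n m j +_) (sym (*-distribˡ-sumTo n (ℕ→ℚ (suc j)) _)) ⟩
  stirlingProduct n m j + ℕ→ℚ (suc j) * stirlingProduct n m (suc j) ∎
  where
  open ≡-Reasoning
  s = signedStirling1 n
  S : ℕ → ℕ → ℕ
  S i = stirling2 (m ℕ.+ i)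
  split : ∀ i → s i * ℕ→ℚ (S i j ℕ.+ suc j ℕ.* S i (suc j))
              ≡ s i * ℕ→ℚ (S i j) + ℕ→ℚ (suc j) * (s i * ℕ→ℚ (S i (suc j)))
  split i = trans
    (cong (s i *_) (trans (ℕ→ℚ-+ (S i j) (suc j ℕ.* S i (suc j)))
                          (cong (ℕ→ℚ (S i j) +_) (ℕ→ℚ-* (suc j) (S i (suc j))))))
    (solve 4 (λ s a q b → s :* (a :+ q :* b) := s :* a :+ q :* (s :* b)) refl
       (s i) (ℕ→ℚ (S i j)) (ℕ→ℚ (suc j)) (ℕ→ℚ (S i (suc j))))

ℕ→ℚ-*-δ : ∀ a b → ℕ→ℚ b * δ a b ≡ ℕ→ℚ a * δ a b
ℕ→ℚ-*-δ zero    zero    = refl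
ℕ→ℚ-*-δ zero    (suc b) = trans (*-zeroʳ (ℕ→ℚ (suc b))) (sym (*-zeroʳ (ℕ→ℚ 0)))
ℕ→ℚ-*-δ (suc a) zero    = trans (*-zeroʳ (ℕ→ℚ 0)) (sym (*-zeroʳ (ℕ→ℚ (suc a))))
ℕ→ℚ-*-δ (suc a) (suc b) = begin
  ℕ→ℚ (1 ℕ.+ b) * δ a b          ≡⟨ cong (_* δ a b) (ℕ→ℚ-+ 1 b) ⟩
  (1ℚ + ℕ→ℚ b) * δ a b           ≡⟨ *-distribʳ-+ (δ a b) 1ℚ (ℕ→ℚ b) ⟩
  1ℚ * δ a b + ℕ→ℚ b * δ a b     ≡⟨ cong (1ℚ * δ a b +_) (ℕ→ℚ-*-δ a b) ⟩
  1ℚ * δ a b + ℕ→ℚ a * δ a b     ≡⟨ sym (*-distribʳ-+ (δ a b) 1ℚ (ℕ→ℚ a)) ⟩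
  (1ℚ + ℕ→ℚ a) * δ a b           ≡⟨ cong (_* δ a b) (sym (ℕ→ℚ-+ 1 a)) ⟩
  ℕ→ℚ (1 ℕ.+ a) * δ a b          ∎
  where open ≡-Reasoning

δ-< : ∀ a b → b < a → δ a b ≡ 0ℚ
δ-< (suc a) zero    _         = refl
δ-< (suc a) (suc b) (s≤s b<a) = δ-< a b b<a

δ-+ : ∀ a p → δ a (a ℕ.+ p) ≡ δ 0 p
δ-+ zero    p = refl
δ-+ (suc a) p = δ-+ a p

stirlingProduct-zero-shift : ∀ n j → stirlingProduct n 0 (suc j) ≡
  sumTo n (λ i → signedStirling1 n (suc i) * ℕ→ℚ (stirling2 (suc i) (suc j)))
stirlingProduct-zero-shift n j = begin
  sumTo n h                                  ≡⟨ sym (+-identityʳ _) ⟩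
  sumTo n h + 0ℚ                             ≡⟨ cong (sumTo n h +_) (sym h-last) ⟩
  sumTo (suc n) h                            ≡⟨ sumTo-head n h ⟩
  h 0 + sumTo n (λ i → h (suc i))            ≡⟨ cong (_+ sumTo n (λ i → h (suc i))) (*-zeroʳ (signedStirling1 n 0)) ⟩
  0ℚ + sumTo n (λ i → h (suc i))             ≡⟨ +-identityˡ _ ⟩
  sumTo n (λ i → h (suc i))                  ∎
  where
  open ≡-Reasoning
  h : ℕ → ℚ
  h i = signedStirling1 n i * ℕ→ℚ (stirling2 i (suc j))
  h-last : h (suc n) ≡ 0ℚ
  h-last = trans (cong (_* ℕ→ℚ (stirling2 (suc n) (suc j))) (signedStirling1-vanishes n (suc n) ℕ.≤-refl))
                 (*-zeroˡ (ℕ→ℚ (stirling2 (suc n) (suc j))))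

-- Expand s(n+1, ·) by its recurrence; the resulting sum over S(i+1, j+1) is stirlingProduct n 1 (j+1),
-- which splits by the recurrence of S.
stirling-orthogonality : ∀ n j → stirlingProduct n 0 j ≡ δ n j
stirling-orthogonality zero    zero    = refl
stirling-orthogonality zero    (suc j) = refl
stirling-orthogonality (suc n) zero    = sumTo-zero (suc n) term≡0
  where
  term≡0 : ∀ i → i ≤ suc n → signedStirling1 (suc n) i * ℕ→ℚ (stirling2 i 0) ≡ 0ℚ
  term≡0 zero    _ = trans (cong (_* 1ℚ) (signedStirling1-suc-zero n)) (*-zeroˡ 1ℚ)
  term≡0 (suc i) _ = *-zeroʳ (signedStirling1 (suc n) (suc i))
stirling-orthogonality (suc n) (suc j) = begin
  sumTo (suc n) (λ i → s (suc n) i * X i)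
    ≡⟨ sumTo-head n (λ i → s (suc n) i * X i) ⟩
  s (suc n) 0 * X 0 + sumTo n (λ i → s (suc n) (suc i) * X (suc i))
    ≡⟨ cong₂ _+_ (*-zeroʳ (s (suc n) 0)) (sumTo-cong n expand) ⟩
  0ℚ + sumTo n (λ i → s n i * X (suc i) - ℕ→ℚ n * (s n (suc i) * X (suc i)))
    ≡⟨ trans (+-identityˡ _) (sumTo-distrib-sub n (λ i → s n i * X (suc i)) (λ i → ℕ→ℚ n * (s n (suc i) * X (suc i)))) ⟩
  stirlingProduct n 1 (suc j) - sumTo n (λ i → ℕ→ℚ n * (s n (suc i) * X (suc i)))
    ≡⟨ cong₂ _-_ (stirlingProduct-suc n 0 j)
                 (trans (sym (*-distribˡ-sumTo n (ℕ→ℚ n) _)) (cong (ℕ→ℚ n *_) (sym (stirlingProduct-zero-shift n j)))) ⟩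
  (stirlingProduct n 0 j + q * stirlingProduct n 0 (suc j)) - ℕ→ℚ n * stirlingProduct n 0 (suc j)
    ≡⟨ cong₂ (λ u v → (u + q * v) - ℕ→ℚ n * v) (stirling-orthogonality n j) (stirling-orthogonality n (suc j)) ⟩
  (δ n j + q * δ n (suc j)) - ℕ→ℚ n * δ n (suc j)
    ≡⟨ cong (λ v → (δ n j + v) - ℕ→ℚ n * δ n (suc j)) (ℕ→ℚ-*-δ n (suc j)) ⟩
  (δ n j + ℕ→ℚ n * δ n (suc j)) - ℕ→ℚ n * δ n (suc j)
    ≡⟨ solve 2 (λ d e → (d :+ e) :- e := d) refl (δ n j) (ℕ→ℚ n * δ n (suc j)) ⟩
  δ n j ∎
  where
  open ≡-Reasoning
  s = signedStirling1
  q = ℕ→ℚ (suc j)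
  X : ℕ → ℚ
  X i = ℕ→ℚ (stirling2 i (suc j))
  expand : ∀ i → s (suc n) (suc i) * X (suc i) ≡ s n i * X (suc i) - ℕ→ℚ n * (s n (suc i) * X (suc i))
  expand i = trans (cong (_* X (suc i)) (signedStirling1-suc n i))
    (solve 4 (λ a b c x → (a :- b :* c) :* x := a :* x :- b :* (c :* x)) refl (s n i) (ℕ→ℚ n) (s n (suc i)) (X (suc i)))

stirlingProduct-vanishes : ∀ n m j → j < n → stirlingProduct n m j ≡ 0ℚ
stirlingProduct-vanishes n zero    j       j<n = trans (stirling-orthogonality n j) (δ-< n j j<n)
stirlingProduct-vanishes n (suc m) zero    _   = sumTo-zero n (λ i _ → *-zeroʳ (signedStirling1 n i))
stirlingProduct-vanishes n (suc m) (suc j) j<n = begin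
  stirlingProduct n (suc m) (suc j)                                 ≡⟨ stirlingProduct-suc n m j ⟩
  stirlingProduct n m j + ℕ→ℚ (suc j) * stirlingProduct n m (suc j)
    ≡⟨ cong₂ (λ x y → x + ℕ→ℚ (suc j) * y) (stirlingProduct-vanishes n m j (ℕ.<-trans (ℕ.n<1+n j) j<n))
                                           (stirlingProduct-vanishes n m (suc j) j<n) ⟩
  0ℚ + ℕ→ℚ (suc j) * 0ℚ
    ≡⟨ solve 1 (λ q → con 0ℚ :+ q :* con 0ℚ := con 0ℚ) refl (ℕ→ℚ (suc j)) ⟩
  0ℚ ∎
  where open ≡-Reasoning

stirlingProduct-suc-diag : ∀ n m → stirlingProduct n (suc m) n ≡ ℕ→ℚ n * stirlingProduct n m n
stirlingProduct-suc-diag zero    m = trans (*-zeroʳ (signedStirling1 0 0)) (sym (*-zeroˡ (stirlingProduct 0 m 0)))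
stirlingProduct-suc-diag (suc n) m = begin
  stirlingProduct (suc n) (suc m) (suc n)                        ≡⟨ stirlingProduct-suc (suc n) m n ⟩
  stirlingProduct (suc n) m n + ℕ→ℚ (suc n) * stirlingProduct (suc n) m (suc n)
    ≡⟨ cong (_+ ℕ→ℚ (suc n) * stirlingProduct (suc n) m (suc n)) (stirlingProduct-vanishes (suc n) m n ℕ.≤-refl) ⟩
  0ℚ + ℕ→ℚ (suc n) * stirlingProduct (suc n) m (suc n)          ≡⟨ +-identityˡ _ ⟩
  ℕ→ℚ (suc n) * stirlingProduct (suc n) m (suc n)               ∎
  where open ≡-Reasoning

stirlingCoeff : ℕ → ℕ → ℕ → ℚ
stirlingCoeff n m p = ℕ→ℚ (p !) * sgn (m ℕ.+ p) * stirlingProduct n m (n ℕ.+ p)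

stirlingCoeff-zero : ∀ n p → stirlingCoeff n 0 p ≡ δ 0 p
stirlingCoeff-zero n p =
  trans (cong (ℕ→ℚ (p !) * sgn p *_) (trans (stirling-orthogonality n (n ℕ.+ p)) (δ-+ n p))) (scale p)
  where
  scale : ∀ p → ℕ→ℚ (p !) * sgn p * δ 0 p ≡ δ 0 p
  scale zero    = refl
  scale (suc p) = *-zeroʳ (ℕ→ℚ (suc p !) * sgn (suc p))

stirlingCoeff-suc-zero : ∀ n m → stirlingCoeff n (suc m) 0 ≡ - ℕ→ℚ n * stirlingCoeff n m 0
stirlingCoeff-suc-zero n m = begin
  ℕ→ℚ 1 * ((- 1ℚ) * sgn (m ℕ.+ 0)) * stirlingProduct n (suc m) (n ℕ.+ 0)
    ≡⟨ cong (λ j → ℕ→ℚ 1 * ((- 1ℚ) * sgn (m ℕ.+ 0)) * stirlingProduct n (suc m) j) (ℕ.+-identityʳ n) ⟩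
  ℕ→ℚ 1 * ((- 1ℚ) * sgn (m ℕ.+ 0)) * stirlingProduct n (suc m) n
    ≡⟨ cong (ℕ→ℚ 1 * ((- 1ℚ) * sgn (m ℕ.+ 0)) *_) (stirlingProduct-suc-diag n m) ⟩
  ℕ→ℚ 1 * ((- 1ℚ) * sgn (m ℕ.+ 0)) * (ℕ→ℚ n * stirlingProduct n m n)
    ≡⟨ solve 4 (λ o s y x → o :* (:- con 1ℚ :* s) :* (y :* x) := (:- y) :* (o :* s :* x)) refl
         (ℕ→ℚ 1) (sgn (m ℕ.+ 0)) (ℕ→ℚ n) (stirlingProduct n m n) ⟩
  - ℕ→ℚ n * (ℕ→ℚ 1 * sgn (m ℕ.+ 0) * stirlingProduct n m n)
    ≡⟨ cong (λ j → - ℕ→ℚ n * (ℕ→ℚ 1 * sgn (m ℕ.+ 0) * stirlingProduct n m j)) (sym (ℕ.+-identityʳ n)) ⟩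
  - ℕ→ℚ n * stirlingCoeff n m 0 ∎
  where open ≡-Reasoning

stirlingCoeff-suc-suc : ∀ n m p → stirlingCoeff n (suc m) (suc p) ≡
  - ℕ→ℚ n * stirlingCoeff n m (suc p) + ℕ→ℚ (suc p) * (stirlingCoeff n m p - stirlingCoeff n m (suc p))
stirlingCoeff-suc-suc n m p = begin
  stirlingCoeff n (suc m) (suc p)
    ≡⟨ cong₂ (λ u σ → u * ((- 1ℚ) * σ) * stirlingProduct n (suc m) (n ℕ.+ suc p)) fact sign ⟩
  q * c * ((- 1ℚ) * ((- 1ℚ) * s)) * stirlingProduct n (suc m) (n ℕ.+ suc p)
    ≡⟨ cong (q * c * ((- 1ℚ) * ((- 1ℚ) * s)) *_) next ⟩
  q * c * ((- 1ℚ) * ((- 1ℚ) * s)) * (A + (y + q) * B)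
    ≡⟨ solve 6 (λ y q c s A B → q :* c :* (:- con 1ℚ :* (:- con 1ℚ :* s)) :* (A :+ (y :+ q) :* B)
                  := (:- y) :* (q :* c :* (:- con 1ℚ :* s) :* B) :+ q :* (c :* s :* A :- q :* c :* (:- con 1ℚ :* s) :* B))
         refl y q c s A B ⟩
  - y * (q * c * ((- 1ℚ) * s) * B) + q * (c * s * A - q * c * ((- 1ℚ) * s) * B)
    ≡⟨ cong (λ z → - y * z + q * (c * s * A - z)) (sym coeff-suc) ⟩
  - y * stirlingCoeff n m (suc p) + q * (stirlingCoeff n m p - stirlingCoeff n m (suc p)) ∎
  where
  open ≡-Reasoning
  y = ℕ→ℚ n
  q = ℕ→ℚ (suc p)
  c = ℕ→ℚ (p !)
  s = sgn (m ℕ.+ p)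
  A = stirlingProduct n m (n ℕ.+ p)
  B = stirlingProduct n m (suc (n ℕ.+ p))
  fact : ℕ→ℚ (suc p !) ≡ q * c
  fact = ℕ→ℚ-* (suc p) (p !)
  sign : sgn (m ℕ.+ suc p) ≡ (- 1ℚ) * s
  sign = cong sgn (ℕ.+-suc m p)
  next : stirlingProduct n (suc m) (n ℕ.+ suc p) ≡ A + (y + q) * B
  next = begin
    stirlingProduct n (suc m) (n ℕ.+ suc p)       ≡⟨ cong (stirlingProduct n (suc m)) (ℕ.+-suc n p) ⟩
    stirlingProduct n (suc m) (suc (n ℕ.+ p))     ≡⟨ stirlingProduct-suc n m (n ℕ.+ p) ⟩
    A + ℕ→ℚ (suc (n ℕ.+ p)) * B
      ≡⟨ cong (λ z → A + z * B) (trans (cong ℕ→ℚ (sym (ℕ.+-suc n p))) (ℕ→ℚ-+ n (suc p))) ⟩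
    A + (y + q) * B ∎
  coeff-suc : stirlingCoeff n m (suc p) ≡ q * c * ((- 1ℚ) * s) * B
  coeff-suc = trans (cong₂ (λ u v → u * sgn (m ℕ.+ suc p) * v) fact (cong (stirlingProduct n m) (ℕ.+-suc n p)))
                    (cong (λ σ → q * c * σ * B) sign)

coeff!-expPow-stirlingCoeff : ∀ n m p → coeff! (expPow (- ℕ→ℚ n) p) m ≡ stirlingCoeff n m p
coeff!-expPow-stirlingCoeff n zero    p       = trans (coeff!-expPow-zero (- ℕ→ℚ n) p) (sym (stirlingCoeff-zero n p))
coeff!-expPow-stirlingCoeff n (suc m) zero    = begin
  coeff! (expPow a 0) (suc m)            ≡⟨ coeff!-expPow-suc-zero a m ⟩
  a * coeff! (expPow a 0) m              ≡⟨ cong (a *_) (coeff!-expPow-stirlingCoeff n m 0) ⟩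
  a * stirlingCoeff n m 0                ≡⟨ sym (stirlingCoeff-suc-zero n m) ⟩
  stirlingCoeff n (suc m) 0              ∎
  where
  open ≡-Reasoning
  a = - ℕ→ℚ n
coeff!-expPow-stirlingCoeff n (suc m) (suc p) = begin
  coeff! (expPow a (suc p)) (suc m)
    ≡⟨ coeff!-expPow-suc-suc a m p ⟩
  a * coeff! (expPow a (suc p)) m + ℕ→ℚ (suc p) * (coeff! (expPow a p) m - coeff! (expPow a (suc p)) m)
    ≡⟨ cong₂ (λ x y → a * y + ℕ→ℚ (suc p) * (x - y))
             (coeff!-expPow-stirlingCoeff n m p) (coeff!-expPow-stirlingCoeff n m (suc p)) ⟩
  a * stirlingCoeff n m (suc p) + ℕ→ℚ (suc p) * (stirlingCoeff n m p - stirlingCoeff n m (suc p))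
    ≡⟨ sym (stirlingCoeff-suc-suc n m p) ⟩
  stirlingCoeff n (suc m) (suc p) ∎
  where
  open ≡-Reasoning
  a = - ℕ→ℚ n

-- The two exponents differ by the even number 2i; truncated subtraction is harmless since i ≤ n.
sgn-exponent : ∀ m n p i → i ≤ n → sgn (m ℕ.+ n ℕ.+ suc p ∸ i ∸ 1) ≡ sgn (m ℕ.+ p) * sgn (n ℕ.+ i)
sgn-exponent m n p i i≤n with ℕ.m≤n⇒∃[o]m+o≡n i≤n
... | r , refl = begin
  sgn (m ℕ.+ (i ℕ.+ r) ℕ.+ suc p ∸ i ∸ 1)
    ≡⟨ cong (λ e → sgn (e ∸ i ∸ 1)) reorder₁ ⟩
  sgn (suc (m ℕ.+ r ℕ.+ p) ℕ.+ i ∸ i ∸ 1)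
    ≡⟨ cong (λ e → sgn (e ∸ 1)) (ℕ.m+n∸n≡m (suc (m ℕ.+ r ℕ.+ p)) i) ⟩
  sgn (m ℕ.+ r ℕ.+ p)
    ≡⟨ sym (trans (cong (sgn (m ℕ.+ r ℕ.+ p) *_) (sgn-+-self i)) (*-identityʳ _)) ⟩
  sgn (m ℕ.+ r ℕ.+ p) * sgn (i ℕ.+ i)
    ≡⟨ sym (^ℚ-+ (- 1ℚ) (m ℕ.+ r ℕ.+ p) (i ℕ.+ i)) ⟩
  sgn (m ℕ.+ r ℕ.+ p ℕ.+ (i ℕ.+ i))
    ≡⟨ cong sgn reorder₂ ⟩
  sgn (m ℕ.+ p ℕ.+ (i ℕ.+ r ℕ.+ i))
    ≡⟨ ^ℚ-+ (- 1ℚ) (m ℕ.+ p) (i ℕ.+ r ℕ.+ i) ⟩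
  sgn (m ℕ.+ p) * sgn (i ℕ.+ r ℕ.+ i) ∎
  where
  open ≡-Reasoning
  reorder₁ : m ℕ.+ (i ℕ.+ r) ℕ.+ suc p ≡ suc (m ℕ.+ r ℕ.+ p) ℕ.+ i
  reorder₁ = ℕ-Solver.solve (m ∷ i ∷ r ∷ p ∷ [])
  reorder₂ : m ℕ.+ r ℕ.+ p ℕ.+ (i ℕ.+ i) ≡ m ℕ.+ p ℕ.+ (i ℕ.+ r ℕ.+ i)
  reorder₂ = ℕ-Solver.solve (m ∷ i ∷ r ∷ p ∷ [])

*-distribˡ-stirlingCoeff : ∀ n m p w → w * stirlingCoeff n m p ≡ sumTo n (λ i →
  sgn (m ℕ.+ n ℕ.+ suc p ∸ i ∸ 1) * (ℕ→ℚ (p !) * w) * ℕ→ℚ (stirling1 n i) * ℕ→ℚ (stirling2 (m ℕ.+ i) (n ℕ.+ suc p ∸ 1)))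
*-distribˡ-stirlingCoeff n m p w = begin
  w * (f * s * stirlingProduct n m (n ℕ.+ p))
    ≡⟨ sym (*-assoc w (f * s) _) ⟩
  w * (f * s) * stirlingProduct n m (n ℕ.+ p)
    ≡⟨ *-distribˡ-sumTo n (w * (f * s)) _ ⟩
  sumTo n (λ i → w * (f * s) * (sgn (n ℕ.+ i) * ℕ→ℚ (stirling1 n i) * X i))
    ≡⟨ sumTo-cong≤ n term ⟩
  _ ∎
  where
  open ≡-Reasoning
  f = ℕ→ℚ (p !)
  s = sgn (m ℕ.+ p)
  X : ℕ → ℚ
  X i = ℕ→ℚ (stirling2 (m ℕ.+ i) (n ℕ.+ p))
  term : ∀ i → i ≤ n → w * (f * s) * (sgn (n ℕ.+ i) * ℕ→ℚ (stirling1 n i) * X i) ≡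
    sgn (m ℕ.+ n ℕ.+ suc p ∸ i ∸ 1) * (f * w) * ℕ→ℚ (stirling1 n i) * ℕ→ℚ (stirling2 (m ℕ.+ i) (n ℕ.+ suc p ∸ 1))
  term i i≤n = begin
    w * (f * s) * (sgn (n ℕ.+ i) * ℕ→ℚ (stirling1 n i) * X i)
      ≡⟨ solve 6 (λ w f s t y x → w :* (f :* s) :* (t :* y :* x) := s :* t :* (f :* w) :* y :* x) refl
           w f s (sgn (n ℕ.+ i)) (ℕ→ℚ (stirling1 n i)) (X i) ⟩
    s * sgn (n ℕ.+ i) * (f * w) * ℕ→ℚ (stirling1 n i) * X i
      ≡⟨ cong₂ (λ σ j → σ * (f * w) * ℕ→ℚ (stirling1 n i) * ℕ→ℚ (stirling2 (m ℕ.+ i) j))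
               (sym (sgn-exponent m n p i i≤n)) (cong (_∸ 1) (sym (ℕ.+-suc n p))) ⟩
    sgn (m ℕ.+ n ℕ.+ suc p ∸ i ∸ 1) * (f * w) * ℕ→ℚ (stirling1 n i) * ℕ→ℚ (stirling2 (m ℕ.+ i) (n ℕ.+ suc p ∸ 1)) ∎

proposition2p4 : (m n : ℕ) (k : ℤ) →
    polyBernoulli m k (ℕ→ℚ n)
      ≡ sumTo m (λ p → sumTo n (λ i →
          ((- 1ℚ) ^ℚ (m ℕ.+ n ℕ.+ suc p ∸ i ∸ 1))
          * (ℕ→ℚ (p !) * invPow (suc p) k)
          * ℕ→ℚ (stirling1 n i)
          * ℕ→ℚ (stirling2 (m ℕ.+ i) (n ℕ.+ suc p ∸ 1))))
proposition2p4 m n k = begin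
  ℕ→ℚ (m !) * (expS a ⊛ liQuot k) m
    ≡⟨ cong (ℕ→ℚ (m !) *_) (⊛-sumTo-triangular (expS a) c c-vanishes m) ⟩
  ℕ→ℚ (m !) * sumTo m (λ p → (expS a ⊛ c p) m)
    ≡⟨ *-distribˡ-sumTo m (ℕ→ℚ (m !)) _ ⟩
  sumTo m (λ p → ℕ→ℚ (m !) * (expS a ⊛ c p) m)
    ≡⟨ sumTo-cong m (λ p → cong (ℕ→ℚ (m !) *_) (⊛-*ʳ (expS a) (w p) (powS oneMinusExpNeg p) m)) ⟩
  sumTo m (λ p → ℕ→ℚ (m !) * (w p * expPow a p m))
    ≡⟨ sumTo-cong m (λ p → trans (solve 3 (λ f w x → f :* (w :* x) := w :* (f :* x)) refl (ℕ→ℚ (m !)) (w p) (expPow a p m))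
                                (cong (w p *_) (coeff!-expPow-stirlingCoeff n m p))) ⟩
  sumTo m (λ p → w p * stirlingCoeff n m p)
    ≡⟨ sumTo-cong m (λ p → *-distribˡ-stirlingCoeff n m p (w p)) ⟩
  _ ∎
  where
  open ≡-Reasoning
  a = - ℕ→ℚ n
  w : ℕ → ℚ
  w p = invPow (suc p) k
  c : ℕ → Series
  c p N = w p * powS oneMinusExpNeg p N
  c-vanishes : ∀ p → c p VanishesBelow p
  c-vanishes p N N<p = trans (cong (w p *_) (powS-vanishesBelow oneMinusExpNeg-vanishesBelow p N N<p)) (*-zeroʳ (w p))
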